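{- Let $\delta\in\{\mathsf{none},\mathsf{down},\mathsf{up},\mathsf{updown}\}^n$. The map $f:\mathcal{PT}_n(\delta)\to\mathcal{C}_\delta$, $f(T)=\vec{c}(T)$, sending a $\delta$-permutree to its cubic vector is injective.
   Context: A permutree on $n$ vertices is a directed (unrooted, planar) tree $T$ with vertex set $\{v_1,\dots,v_n\}$, edges oriented from child to parent, such that each vertex $v_i$ has exactly one or two parents and exactly one or two children, and: if $v_i$ has two parents then every vertex $v_j$ in its left ancestor subtree has $j<i$ and every $v_k$ in its right ancestor subtree has $k>i$; if $v_i$ has two children then every $v_j$ in its left descendant subtree $LD_i$ has $j<i$ and every $v_k$ in its right descendant subtree $RD_i$ has $k>i$ (ancestor/descendant subtrees are the components of $T\setminus v_i$ containing the respective parents/children; if $v_i$ has one child, $D_i$ denotes its unique descendant subtree). The decoration $\delta(T)_i$ is $\mathsf{none}$, $\mathsf{down}$, $\mathsf{up}$, $\mathsf{updown}$ according as $v_i$ has (one parent, one child), (one parent, two children), (two parents, one child), (two parents, two children); $\mathcal{PT}_n(\delta)$ is the set of permutrees with decoration $\delta$ (convention $\delta_1=\delta_n=\mathsf{none}$). The cubic set of $T$ is $C(T)=\{(i,j): i<j,\ v_j\in D_i\text{ if }\delta_i\in\{\mathsf{none},\mathsf{up}\};\ v_j\in RD_i\text{ if }\delta_i\in\{\mathsf{down},\mathsf{updown}\}\}$, with components $C(T)_i=\{j:(i,j)\in C(T)\}$, and the cubic vector is $\vec{c}(T)=(c_1,\dots,c_{n-1})$ with $c_i=|C(T)_i|$.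 $\mathcal{C}_\delta$ is the convex hull of all cubic vectors of $\delta$-permutrees. -}

module Defs where

open import Data.Nat using (ℕ; zero; suc; _+_; _≤_)
open import Data.Fin using (Fin; toℕ; zero; suc; _<_)
open import Data.Bool using (Bool; true; false; if_then_else_)
open import Data.Product using (Σ; _×_; ∃; _,_)
open import Data.Sum using (_⊎_)
open import Data.List using (List; length)
open import Data.List.Relation.Unary.Unique.Propositional using (Unique)
open import Data.List.Membership.Propositional using (_∈_)
open import Relation.Binary.PropositionalEquality using (_≡_; _≢_)
open import Relation.Binary.Construct.Closure.ReflexiveTransitive using (Star)
open import Relation.Nullary using (¬_)
open import Data.Unit using (⊤)
open import Function.Bundles using (_⇔_)

data Decoration : Set where
  none down up updown : Decoration

-- number of parent slots / child slots of a vertex with a given decoration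
-- (slots may be filled by a labelled vertex or be dangling edges)
parentSlots : Decoration → ℕ
parentSlots none   = 1
parentSlots down   = 1
parentSlots up     = 2
parentSlots updown = 2

childSlots : Decoration → ℕ
childSlots none   = 1
childSlots down   = 2
childSlots up     = 1
childSlots updown = 2

countᵇ : ∀ {n} → (Fin n → Bool) → ℕ
countᵇ {zero}  f = 0
countᵇ {suc n} f = (if f zero then 1 else 0) + countᵇ (λ j → f (suc j))

CardIs : ∀ {n} → (Fin n → Set) → ℕ → Set
CardIs {n} P k =
  Σ (List (Fin n)) λ xs → Unique xs × (∀ j → P j ⇔ (j ∈ xs)) × length xs ≡ k

-- A directed graph on vertices v_1..v_n (= Fin n):
-- E c p ≡ true  iff there is an edge c → p, i.e. c is a child of p.
Digraph : ℕ → Set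
Digraph n = Fin n → Fin n → Bool

module _ {n : ℕ} (E : Digraph n) where

  Edge : Fin n → Fin n → Set
  Edge c p = E c p ≡ true

  Adj : Fin n → Fin n → Set
  Adj x y = Edge x y ⊎ Edge y x

  AdjAvoiding : Fin n → Fin n → Fin n → Set
  AdjAvoiding i x y = Adj x y × x ≢ i × y ≢ i

  ReachAvoiding : Fin n → Fin n → Fin n → Set
  ReachAvoiding i x y = Star (AdjAvoiding i) x y

  AdjWithoutEdge : Fin n → Fin n → Fin n → Fin n → Set
  AdjWithoutEdge x y a b =
    Adj a b × ¬ ((a ≡ x × b ≡ y) ⊎ (a ≡ y × b ≡ x))

  -- directed tree: underlying graph is connected, has no loops / 2-cycles,
  -- and is acyclic (every edge is a bridge)
  IsTree : Set
  IsTree =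
    (∀ x y → Star Adj x y) ×
    (∀ x y → Edge x y → ¬ Edge y x) ×
    (∀ x y → Edge x y → ¬ Star (AdjWithoutEdge x y) x y)

  LeftComp : Fin n → Fin n → Set
  LeftComp i u = ∀ j → ReachAvoiding i u j → j < i

  RightComp : Fin n → Fin n → Set
  RightComp i u = ∀ j → ReachAvoiding i u j → i < j

  Separated : Fin n → (Fin n → Set) → Set
  Separated i Nbr =
    (∀ u → Nbr u → LeftComp i u ⊎ RightComp i u) ×
    (∀ u v → Nbr u → Nbr v → u ≢ v → ¬ (LeftComp i u × LeftComp i v)) ×
    (∀ u v → Nbr u → Nbr v → u ≢ v → ¬ (RightComp i u × RightComp i v))

  Parent : Fin n → Fin n → Set
  Parent i p = Edge i p

  Child : Fin n → Fin n → Set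
  Child i c = Edge c i

  ParentCond : Decoration → Fin n → Set
  ParentCond none   i = ⊤
  ParentCond down   i = ⊤
  ParentCond up     i = Separated i (Parent i)
  ParentCond updown i = Separated i (Parent i)

  ChildCond : Decoration → Fin n → Set
  ChildCond none   i = ⊤
  ChildCond down   i = Separated i (Child i)
  ChildCond up     i = ⊤
  ChildCond updown i = Separated i (Child i)

  IsPermutree : (Fin n → Decoration) → Set
  IsPermutree δ =
    IsTree ×
    (∀ i → countᵇ (λ p → E i p) ≤ parentSlots (δ i)
         × countᵇ (λ c → E c i) ≤ childSlots (δ i)
         × ParentCond (δ i) i
         × ChildCond (δ i) i)

  DescSide : Decoration → Fin n → Fin n → Set
  DescSide none   i j = ∃ λ c → Child i c × ReachAvoiding i c j
  DescSide up     i j = ∃ λ c → Child i c × ReachAvoiding i c j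
  DescSide down   i j = ∃ λ c → Child i c × RightComp i c × ReachAvoiding i c j
  DescSide updown i j = ∃ λ c → Child i c × RightComp i c × ReachAvoiding i c j

  CubicComponent : (Fin n → Decoration) → Fin n → Fin n → Set
  CubicComponent δ i j = i < j × DescSide (δ i) i j

-- The trees are rebuilt by inserting the vertices in decreasing order. Say that x and y are joined at z when
-- they lie in one component of T ∖ z, and that y is below (above) z when that component is a descendant
-- (ancestor) subtree of z. By downward induction on t, the joined and below relations among the vertices ≥ t
-- coincide in T₁ and T₂; for t = 0 they determine the edges. When i is added, C(T)_i is the set of larger
-- vertices below i. Were some j > i below i in T₁ but above i in T₂, equal sizes of C(T₁)_i and C(T₂)_i would give
-- a k > i doing the opposite; the nearest larger neighbours of i below and above it in both trees, which the
-- permutree conditions force into few relative positions, exclude this. So i has the same nearest larger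
-- neighbours in both trees, and they determine every relation involving i.
module Submission where

open import Defs
open import Data.Bool using (Bool; true)
open import Data.Bool.Properties using (⇔→≡)
open import Data.Empty using (⊥; ⊥-elim)
open import Data.Fin using (Fin; toℕ; zero; suc; _<_; fromℕ<)
open import Data.Fin.Properties using (_≟_; _<?_; toℕ<n; toℕ-injective; toℕ-fromℕ<; <-cmp; <-trans; <-asym; <⇒≢)
open import Data.List using (List; []; _∷_; length)
open import Data.List.Membership.Propositional using (_∈_; _∉_; find)
open import Data.List.Relation.Binary.Subset.Propositional using (_⊆_)
import Data.List.Relation.Unary.All as All
open import Data.List.Relation.Unary.All using (all?)
open import Data.List.Relation.Unary.All.Properties using (¬All⇒Any¬)
open import Data.List.Relation.Unary.AllPairs using (_∷_)
open import Data.List.Relation.Unary.Any using (here; there)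
open import Data.List.Relation.Unary.Unique.Propositional using (Unique)
open import Data.Nat using (ℕ; suc; zero)
import Data.Nat as N
import Data.Nat.Properties as NP
open import Data.Product using (Σ; ∃; _×_; _,_; proj₁; proj₂)
open import Data.Sum using (_⊎_; inj₁; inj₂)
import Data.Sum as Sum
open import Function using (case_of_)
open import Function.Bundles using (Equivalence; _⇔_; mk⇔)
open import Relation.Binary.Construct.Closure.ReflexiveTransitive using (Star; ε; _◅_; _◅◅_)
  renaming (map to Star-map; reverse to Star-reverse)
open import Relation.Binary.Definitions using (Tri; tri<; tri≈; tri>; DecidableEquality)
open import Relation.Binary.PropositionalEquality using (_≡_; _≢_; refl; sym; trans; cong; subst; subst₂; ≢-sym)
open import Relation.Nullary using (¬_; yes; no; Dec)
import Relation.Nullary.Decidable as Dec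
open import Relation.Nullary.Decidable using (_×-dec_)
open import Relation.Unary using (Decidable)

>⇒≢ : ∀ {n} {i w : Fin n} → i < w → w ≢ i
>⇒≢ i<w = ≢-sym (<⇒≢ i<w)

steps : ∀ {A : Set} {Q : A → A → Set} {x y} → Star Q x y → ℕ
steps ε = 0
steps (_ ◅ p) = suc (steps p)

module TreeProperties {n : ℕ} (E : Digraph n) (isTree : IsTree E) where

  Joined : Fin n → Fin n → Fin n → Set
  Joined = ReachAvoiding E

  private
    connected = proj₁ isTree
    asymmetric = proj₁ (proj₂ isTree)
    bridge = proj₂ (proj₂ isTree)

  Edge-irrefl : ∀ {x} → ¬ Edge E x x
  Edge-irrefl e = asymmetric _ _ e e

  Adj-irrefl : ∀ {x} → ¬ Adj E x x
  Adj-irrefl (inj₁ e) = Edge-irrefl e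
  Adj-irrefl (inj₂ e) = Edge-irrefl e

  Adj-sym : ∀ {x y} → Adj E x y → Adj E y x
  Adj-sym (inj₁ e) = inj₂ e
  Adj-sym (inj₂ e) = inj₁ e

  Adj⇒≢ : ∀ {x y} → Adj E x y → x ≢ y
  Adj⇒≢ a refl = Adj-irrefl a

  Joined-step : ∀ {z x y} → Adj E x y → x ≢ z → y ≢ z → Joined z x y
  Joined-step a x≢z y≢z = (a , x≢z , y≢z) ◅ ε

  Joined-sym : ∀ {z x y} → Joined z x y → Joined z y x
  Joined-sym = Star-reverse λ { (a , x≢z , y≢z) → Adj-sym a , y≢z , x≢z }

  Joined-trans : ∀ {z x y w} → Joined z x y → Joined z y w → Joined z x w
  Joined-trans = _◅◅_

  Joined-to-centre : ∀ {z x} → Joined z x z → x ≡ z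
  Joined-to-centre ε = refl
  Joined-to-centre ((_ , _ , y≢z) ◅ r) with Joined-to-centre r
  ... | refl = ⊥-elim (y≢z refl)

  Joined-from-centre : ∀ {z y} → Joined z z y → y ≡ z
  Joined-from-centre r = Joined-to-centre (Joined-sym r)

  private
    AWE = AdjWithoutEdge E

    AWE-sym : ∀ {x y a b} → AWE x y a b → AWE x y b a
    AWE-sym (a , ne) = Adj-sym a , λ { (inj₁ (p , q)) → ne (inj₂ (q , p)) ; (inj₂ (p , q)) → ne (inj₁ (q , p)) }

    AWE-swap : ∀ {x y a b} → AWE x y a b → AWE y x a b
    AWE-swap (a , ne) = a , λ { (inj₁ (p , q)) → ne (inj₂ (p , q)) ; (inj₂ (p , q)) → ne (inj₁ (p , q)) }

    Joined⇒AWE : ∀ {z w x y} → Joined z x y → Star (AWE z w) x y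
    Joined⇒AWE = Star-map λ { (a , x≢z , y≢z) → a , λ { (inj₁ (e , _)) → x≢z e ; (inj₂ (_ , e)) → y≢z e } }

    Joined⇒AWE′ : ∀ {z w x y} → Joined z x y → Star (AWE w z) x y
    Joined⇒AWE′ r = Star-map AWE-swap (Joined⇒AWE r)

  no-bypass : ∀ {x y} → Adj E x y → ¬ Star (AWE x y) x y
  no-bypass (inj₁ e) p = bridge _ _ e p
  no-bypass (inj₂ e) p = bridge _ _ e (Star-map AWE-swap (Star-reverse AWE-sym p))

  neighbour-unique : ∀ {z u v} → Adj E z u → Adj E z v → Joined z u v → u ≡ v
  neighbour-unique {u = u} {v} au av r with u ≟ v
  ... | yes u≡v = u≡v
  ... | no u≢v = ⊥-elim (no-bypass av
          ((au , λ { (inj₁ (_ , e)) → u≢v e ; (inj₂ (e , _)) → Adj⇒≢ av e }) ◅ Joined⇒AWE r))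

  neighbour-separates : ∀ {a u x} → Adj E a u → Joined a u x → ¬ Joined u x a
  neighbour-separates au r₁ r₂ = no-bypass (Adj-sym au) (Joined⇒AWE′ r₁ ◅◅ Joined⇒AWE r₂)

  Joined-split : ∀ {a u x} (w : Fin n) → Joined a u x → Joined w u x ⊎ (Joined a u w × Joined a w x)
  Joined-split w ε = inj₁ ε
  Joined-split {u = u} w (s@(a , u≢ , _) ◅ r) with u ≟ w
  ... | yes refl = inj₂ (ε , s ◅ r)
  ... | no u≢w with Joined-split w r
  ...   | inj₂ (r₁ , r₂) = inj₂ (s ◅ r₁ , r₂)
  ...   | inj₁ r′ with _ ≟ w
  ...     | no v≢w = inj₁ ((a , u≢w , v≢w) ◅ r′)
  ...     | yes refl = inj₂ (s ◅ ε , r)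

  private
    forget : ∀ {z x y} → Joined z x y → Star (Adj E) x y
    forget = Star-map proj₁

    steps-forget : ∀ {z x y} (r : Joined z x y) → steps (forget r) ≡ steps r
    steps-forget ε = refl
    steps-forget (_ ◅ r) = cong suc (steps-forget r)

  last-visit : ∀ {a y} (π : Star (Adj E) a y) (z : Fin n) → y ≢ z →
    (a ≢ z × Σ (Joined z a y) λ σ → steps σ N.≤ steps π) ⊎
    (Σ (Fin n) λ u → Adj E z u × Σ (Joined z u y) λ σ → steps σ N.< steps π)
  last-visit ε z y≢z = inj₁ (y≢z , ε , N.z≤n)
  last-visit {a} (s ◅ π) z y≢z with last-visit π z y≢z
  ... | inj₂ (u , au , σ , lt) = inj₂ (u , au , σ , NP.m≤n⇒m≤1+n lt)
  ... | inj₁ (w≢z , σ , le) with a ≟ z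
  ...   | yes refl = inj₂ (_ , s , σ , N.s≤s le)
  ...   | no a≢z = inj₁ (a≢z , (s , a≢z , w≢z) ◅ σ , N.s≤s le)

  neighbour-towards : ∀ {z x} → x ≢ z → Σ (Fin n) λ u → Adj E z u × Joined z u x
  neighbour-towards {z} {x} x≢z with last-visit (connected z x) z x≢z
  ... | inj₁ (z≢z , _) = ⊥-elim (z≢z refl)
  ... | inj₂ (u , au , σ , _) = u , au , σ

  induction-towards : (b : Fin n) (P : Fin n → Set) → P b →
    (∀ v u → v ≢ b → Adj E v u → Joined v u b → P u → P v) → ∀ v → P v
  induction-towards b P Pb step v = go (steps (connected v b)) v (connected v b) NP.≤-refl
    where
    go : ∀ k v (π : Star (Adj E) v b) → steps π N.≤ k → P v
    go k v π le with v ≟ b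
    ... | yes refl = Pb
    ... | no v≢b with last-visit π v (λ e → v≢b (sym e))
    ...   | inj₁ (v≢v , _) = ⊥-elim (v≢v refl)
    go zero v π le | no v≢b | inj₂ (u , au , σ , lt) = ⊥-elim (NP.n≮0 (NP.<-≤-trans lt le))
    go (suc k) v π le | no v≢b | inj₂ (u , au , σ , lt) =
      step v u v≢b au σ (go k u (forget σ)
        (subst (N._≤ k) (sym (steps-forget σ)) (NP.≤-pred (NP.<-≤-trans lt le))))

  other-side : ∀ {a a′ x} → Adj E a a′ → ¬ Joined a a′ x → x ≢ a → Joined a′ a x
  other-side {a′ = a′} aa′ nr x≢a with neighbour-towards x≢a
  ... | u , au , r with u ≟ a′
  ...   | yes refl = ⊥-elim (nr r)
  ...   | no u≢a′ with Joined-split a′ r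
  ...     | inj₁ σ = (au , Adj⇒≢ aa′ , u≢a′) ◅ σ
  ...     | inj₂ (_ , r₂) = ⊥-elim (nr r₂)

  Joined? : ∀ z x y → Dec (Joined z x y)
  Joined? z x y with x ≟ z | y ≟ z
  ... | yes refl | yes refl = yes ε
  ... | yes refl | no y≢z = no λ r → y≢z (Joined-from-centre r)
  ... | no x≢z | yes refl = no λ r → x≢z (Joined-to-centre r)
  ... | no x≢z | no y≢z with neighbour-towards x≢z | neighbour-towards y≢z
  ...   | u , au , r | v , av , r′ with u ≟ v
  ...     | yes refl = yes (Joined-trans (Joined-sym r) r′)
  ...     | no u≢v = no λ r″ → u≢v (neighbour-unique au av (Joined-trans r (Joined-trans r″ (Joined-sym r′))))

  separator-joined : ∀ {c i y} → ¬ Joined c i y → c ≢ i → Joined i c y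
  separator-joined {c} {i} {y} nr c≢i with y ≟ c
  ... | yes refl = ε
  ... | no y≢c with neighbour-towards y≢c
  ...   | u , au , r with Joined-split i r
  ...     | inj₁ σ = (au , c≢i , (λ { refl → nr r })) ◅ σ
  ...     | inj₂ (_ , r₂) = ⊥-elim (nr r₂)

  step-keeps-behind : ∀ {a v u b} → Adj E v u → Joined v u b →
    (v ≡ a ⊎ (v ≢ a × ¬ Joined v a b)) → Joined u v a
  step-keeps-behind au r (inj₁ refl) = ε
  step-keeps-behind au r (inj₂ (v≢a , nr)) =
    other-side au (λ r′ → nr (Joined-trans (Joined-sym r′) r)) (λ e → v≢a (sym e))

  -- walk from a towards b; the first vertex whose removal separates a, b and d is the median
  median : ∀ {a b d} → a ≢ b → a ≢ d → Joined a b d → Joined b a d → Joined d a b →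
           Σ (Fin n) λ m → m ≢ a × ¬ Joined m a b × ¬ Joined m b d × ¬ Joined m a d
  median {a} {b} {d} a≢b a≢d jabd jbad jdab =
    induction-towards b P (λ (b≢b , _) → ⊥-elim (b≢b refl)) step a (a≢b , a≢d , inj₁ refl)
    where
    Median = Σ (Fin n) λ m → m ≢ a × ¬ Joined m a b × ¬ Joined m b d × ¬ Joined m a d
    P : Fin n → Set
    P v = v ≢ b × v ≢ d × (v ≡ a ⊎ (v ≢ a × ¬ Joined v a b × ¬ Joined v a d)) → Median
    step : ∀ v u → v ≢ b → Adj E v u → Joined v u b → P u → P v
    step v u v≢b au r Pu (_ , v≢d , h) with Joined? v b d
    step v u v≢b au r Pu (_ , v≢d , inj₁ refl) | no nr = ⊥-elim (nr jabd)
    step v u v≢b au r Pu (_ , v≢d , inj₂ (v≢a , n₁ , n₂)) | no nr = v , v≢a , n₁ , nr , n₂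
    ... | yes jbd = Pu (u≢b , u≢d , inj₂ (u≢a , n-ab , n-ad))
      where
      juva : Joined u v a
      juva = step-keeps-behind au r (Sum.map₂ (λ (x , y , _) → x , y) h)
      n-bv : ¬ Joined u b v
      n-bv = neighbour-separates au r
      n-dv : ¬ Joined u d v
      n-dv = neighbour-separates au (Joined-trans r jbd)
      n-ab : ¬ Joined u a b
      n-ab j = n-bv (Joined-sym (Joined-trans juva j))
      n-ad : ¬ Joined u a d
      n-ad j = n-dv (Joined-sym (Joined-trans juva j))
      u≢a : u ≢ a
      u≢a refl = case h of λ where
        (inj₁ refl) → Adj-irrefl au
        (inj₂ (_ , n₁ , _)) → n₁ r
      u≢b : u ≢ b
      u≢b refl = n-dv (Joined-sym (Joined-trans juva jbad))
      u≢d : u ≢ d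
      u≢d refl = n-bv (Joined-sym (Joined-trans juva jdab))

-- x ⋖ y says that the edge between x and y points from x up to y; reversing it swaps children and parents
record OrientedTree (n : ℕ) : Set₁ where
  field
    E : Digraph n
    isTree : IsTree E
    _⋖_ : Fin n → Fin n → Set
    ⋖⇒Adj : ∀ {x y} → x ⋖ y → Adj E x y
    Adj⇒⋖ : ∀ {x y} → Adj E x y → x ⋖ y ⊎ y ⋖ x
    ⋖-asym : ∀ {x y} → x ⋖ y → ¬ y ⋖ x

  Below Above : Fin n → Fin n → Set
  Below z y = Σ (Fin n) λ c → c ⋖ z × ReachAvoiding E z c y
  Above z y = Σ (Fin n) λ p → z ⋖ p × ReachAvoiding E z p y

  Unseparated : Fin n → Fin n → Set
  Unseparated i c = ∀ w → i < w → w ≢ c → ReachAvoiding E w i c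

  -- c is the vertex larger than i that is adjacent to i below it in the tree restricted to {j ≥ i}
  NearestLargerBelow : Fin n → Fin n → Set
  NearestLargerBelow i c = i < c × Below i c × Above c i × Unseparated i c

reverse : ∀ {n} → OrientedTree n → OrientedTree n
reverse T = record
  { E = E ; isTree = isTree ; _⋖_ = λ x y → y ⋖ x
  ; ⋖⇒Adj = λ o → Adj-sym (⋖⇒Adj o) ; Adj⇒⋖ = λ a → Adj⇒⋖ (Adj-sym a) ; ⋖-asym = λ o o′ → ⋖-asym o′ o }
  where open OrientedTree T
        open TreeProperties E isTree using (Adj-sym)

module OrientedTreeProperties {n : ℕ} (T : OrientedTree n) where
  open OrientedTree T public
  open TreeProperties E isTree public

  below-or-above : ∀ {z y} → y ≢ z → Below z y ⊎ Above z y
  below-or-above y≢z with neighbour-towards y≢z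
  ... | u , au , r with Adj⇒⋖ au
  ...   | inj₁ z⋖u = inj₂ (u , z⋖u , r)
  ...   | inj₂ u⋖z = inj₁ (u , u⋖z , r)

  below⇒¬above : ∀ {z y} → Below z y → ¬ Above z y
  below⇒¬above (c , c⋖z , rc) (p , z⋖p , rp)
    with neighbour-unique (Adj-sym (⋖⇒Adj c⋖z)) (⋖⇒Adj z⋖p) (Joined-trans rc (Joined-sym rp))
  ... | refl = ⋖-asym c⋖z z⋖p

  Below-irrefl : ∀ {z} → ¬ Below z z
  Below-irrefl (c , c⋖z , r) with Joined-to-centre r
  ... | refl = ⋖-asym c⋖z c⋖z

  Above-irrefl : ∀ {z} → ¬ Above z z
  Above-irrefl (p , z⋖p , r) with Joined-to-centre r
  ... | refl = ⋖-asym z⋖p z⋖p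

  Below⇒≢ : ∀ {z y} → Below z y → y ≢ z
  Below⇒≢ b refl = Below-irrefl b

  Above⇒≢ : ∀ {z y} → Above z y → y ≢ z
  Above⇒≢ a refl = Above-irrefl a

  Below-joined : ∀ {z x y} → Below z x → Joined z x y → Below z y
  Below-joined (c , c⋖z , r) r′ = c , c⋖z , Joined-trans r r′

  Above-joined : ∀ {z x y} → Above z x → Joined z x y → Above z y
  Above-joined (p , z⋖p , r) r′ = p , z⋖p , Joined-trans r r′

  ¬below⇒above : ∀ {z y} → y ≢ z → ¬ Below z y → Above z y
  ¬below⇒above y≢z ¬b with below-or-above y≢z
  ... | inj₁ b = ⊥-elim (¬b b)
  ... | inj₂ a = a

  Below? : ∀ z y → Dec (Below z y)
  Below? z y with y ≟ z
  ... | yes refl = no Below-irrefl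
  ... | no y≢z with below-or-above y≢z
  ...   | inj₁ z↓y = yes z↓y
  ...   | inj₂ z↑y = no λ z↓y → below⇒¬above z↓y z↑y

  -- the path between two vertices each above the other climbs to a peak and descends again
  peak : ∀ {a b} → Above a b → Above b a → Σ (Fin n) λ x → Below x a × Below x b × ¬ Joined x a b
  peak {a} {b} a↑b b↑a = induction-towards b P (λ (b↑b , _) → ⊥-elim (Above-irrefl b↑b)) step a (a↑b , b↑a , inj₁ refl)
    where
    Peak = Σ (Fin n) λ x → Below x a × Below x b × ¬ Joined x a b
    P : Fin n → Set
    P v = Above v b × Above b v × (v ≡ a ⊎ (v ≢ a × ¬ Joined v a b)) → Peak
    step : ∀ v u → v ≢ b → Adj E v u → Joined v u b → P u → P v
    step v u v≢b au r Pu ((p , v⋖p , rp) , (q , b⋖q , rq) , h)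
      with neighbour-unique (⋖⇒Adj v⋖p) au (Joined-trans rp (Joined-sym r))
    ... | refl = continue (below-or-above b≢u)
      where
      juva : Joined u v a
      juva = step-keeps-behind au r h
      n-ab : ¬ Joined u a b
      n-ab j = neighbour-separates au r (Joined-sym (Joined-trans juva j))
      b≢u : b ≢ u
      b≢u refl = below⇒¬above (v , v⋖p , ε) (q , b⋖q , rq)
      u≢a : u ≢ a
      u≢a refl = case h of λ where
        (inj₁ refl) → Adj-irrefl au
        (inj₂ (_ , n₁)) → n₁ r
      continue : Below u b ⊎ Above u b → Peak
      continue (inj₁ u↓b) = u , (v , v⋖p , juva) , u↓b , n-ab
      continue (inj₂ u↑b) =
        Pu (u↑b , (q , b⋖q , Joined-trans rq (Joined-step au v≢b λ e → b≢u (sym e))) , inj₂ (u≢a , n-ab))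

-- The permutree conditions in terms of the orientation: the larger vertices below (above) z lie in a single
-- component of T ∖ z, and when z has two lower (upper) neighbours one side holds smaller, the other larger vertices.
record OrientedPermutree (n : ℕ) (TwoBelow TwoAbove : Fin n → Set) : Set₁ where
  field
    tree : OrientedTree n
  open OrientedTree tree public
  field
    larger-below-joined : ∀ {z x y} → z < x → z < y → Below z x → Below z y → ReachAvoiding E z x y
    larger-above-joined : ∀ {z x y} → z < x → z < y → Above z x → Above z y → ReachAvoiding E z x y
    below-split : ∀ {i x a b} → i < x → Below x a → Below x b → ¬ ReachAvoiding E x a b →
                  ReachAvoiding E x i a → a < x × x < b × TwoBelow x
    above-split : ∀ {i x a b} → i < x → Above x a → Above x b → ¬ ReachAvoiding E x a b →
                  ReachAvoiding E x i a → a < x × x < b × TwoAbove x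
    below-straddle : ∀ {i x a} → TwoBelow x → Below x a → ReachAvoiding E x i a → i < x → ¬ x < a
    above-straddle : ∀ {i x a} → TwoAbove x → Above x a → ReachAvoiding E x i a → i < x → ¬ x < a

reverse-permutree : ∀ {n TwoBelow TwoAbove} →
  OrientedPermutree n TwoBelow TwoAbove → OrientedPermutree n TwoAbove TwoBelow
reverse-permutree P = record
  { tree = reverse tree
  ; larger-below-joined = larger-above-joined ; larger-above-joined = larger-below-joined
  ; below-split = above-split ; above-split = below-split
  ; below-straddle = above-straddle ; above-straddle = below-straddle }
  where open OrientedPermutree P

module OrientedPermutreeProperties {n TwoBelow TwoAbove} (P : OrientedPermutree n TwoBelow TwoAbove) where
  open OrientedPermutree P using
    ( larger-below-joined ; larger-above-joined ; below-split ; above-split ; below-straddle ; above-straddle ) public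
  open OrientedTreeProperties (OrientedPermutree.tree P) public

  valley : ∀ {a b} → Below a b → Below b a → Σ (Fin n) λ x → Above x a × Above x b × ¬ Joined x a b
  valley = OrientedTreeProperties.peak (reverse (OrientedPermutree.tree P))

  no-three-larger-components : ∀ {m a b d} → m < a → m < b → m < d →
    ¬ Joined m a b → ¬ Joined m b d → ¬ Joined m a d → ⊥
  no-three-larger-components m<a m<b m<d n-ab n-bd n-ad
    with below-or-above (>⇒≢ m<a) | below-or-above (>⇒≢ m<b) | below-or-above (>⇒≢ m<d)
  ... | inj₁ x | inj₁ y | _      = n-ab (larger-below-joined m<a m<b x y)
  ... | inj₂ x | inj₂ y | _      = n-ab (larger-above-joined m<a m<b x y)
  ... | inj₁ x | inj₂ y | inj₁ z = n-ad (larger-below-joined m<a m<d x z)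
  ... | inj₁ x | inj₂ y | inj₂ z = n-bd (larger-above-joined m<b m<d y z)
  ... | inj₂ x | inj₁ y | inj₁ z = n-bd (larger-below-joined m<b m<d y z)
  ... | inj₂ x | inj₁ y | inj₂ z = n-ad (larger-above-joined m<a m<d x z)

  unseparated-below⇒above : ∀ {i c} → i < c → Below i c → Unseparated i c → Above c i
  unseparated-below⇒above {i} {c} i<c i↓c unsep with below-or-above {c} {i} (≢-sym (>⇒≢ i<c))
  ... | inj₂ c↑i = c↑i
  ... | inj₁ c↓i with valley i↓c c↓i
  ...   | x , x↑i , x↑c , n-ic with <-cmp x i
  ...     | tri< x<i _ _ = ⊥-elim (n-ic (larger-above-joined x<i (<-trans x<i i<c) x↑i x↑c))
  ...     | tri≈ _ refl _ = ⊥-elim (Above-irrefl x↑i)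
  ...     | tri> _ _ i<x = ⊥-elim (n-ic (unsep x i<x (≢-sym (Above⇒≢ x↑c))))

  -- walk from i towards y; the first vertex larger than i met on the way is the nearest one
  nearest-exists : ∀ {i y} → i < y → Below i y →
    Σ (Fin n) λ c → NearestLargerBelow i c × (c ≡ y ⊎ ¬ Joined c i y)
  nearest-exists {i} {y} i<y i↓y with induction-towards y Search Search-y step i (inj₁ refl , λ _ _ _ → ε)
    where
    Candidate = Σ (Fin n) λ c → i < c × Below i c × Unseparated i c × (c ≡ y ⊎ ¬ Joined c i y)
    Behind : Fin n → Set
    Behind v = v ≡ i ⊎ (v < i × ¬ Joined v i y)
    Search : Fin n → Set
    Search v = Behind v × Unseparated i v → Candidate
    Search-y : Search y
    Search-y (inj₁ refl , _) = ⊥-elim (>⇒≢ i<y refl)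
    Search-y (inj₂ (y<i , _) , _) = ⊥-elim (<-asym y<i i<y)
    step : ∀ v u → v ≢ y → Adj E v u → Joined v u y → Search u → Search v
    step v u v≢y au r Search-u (behind , unsep) = continue (<-cmp i u)
      where
      juvi : Joined u v i
      juvi = step-keeps-behind au r (Sum.map₂ (λ (v<i , n) → <⇒≢ v<i , n) behind)
      n-iy : ¬ Joined u i y
      n-iy j = neighbour-separates au r (Joined-sym (Joined-trans juvi j))
      larger≢v : ∀ w → i < w → w ≢ v
      larger≢v w i<w refl = case behind of λ where
        (inj₁ refl) → >⇒≢ i<w refl
        (inj₂ (w<i , _)) → <-asym w<i i<w
      unsep-u : Unseparated i u
      unsep-u w i<w w≢u =
        Joined-trans (unsep w i<w (larger≢v w i<w)) (Joined-step au (≢-sym (larger≢v w i<w)) (≢-sym w≢u))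
      u≢i : u ≢ i
      u≢i refl = case behind of λ where
        (inj₁ refl) → Adj-irrefl au
        (inj₂ (_ , n)) → n r
      continue : Tri (i < u) (i ≡ u) (u < i) → Candidate
      continue (tri< i<u _ _) with u ≟ y
      ... | yes refl = u , i<u , i↓y , unsep-u , inj₁ refl
      ... | no _ = u , i<u , Below-joined i↓y (Joined-sym (separator-joined n-iy u≢i)) , unsep-u , inj₂ n-iy
      continue (tri≈ _ i≡u _) = ⊥-elim (u≢i (sym i≡u))
      continue (tri> _ _ u<i) = Search-u (inj₂ (u<i , n-iy) , unsep-u)
  ... | c , i<c , i↓c , unsep , c-sep = c , (i<c , i↓c , unseparated-below⇒above i<c i↓c unsep , unsep) , c-sep

  -- two distinct candidates would create a median with three components containing larger vertices
  nearest-unique : ∀ {i c c′} → NearestLargerBelow i c → NearestLargerBelow i c′ → c ≡ c′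
  nearest-unique {i} {c} {c′} (i<c , i↓c , _ , unsep) (i<c′ , i↓c′ , _ , unsep′) with c ≟ c′
  ... | yes c≡c′ = c≡c′
  ... | no c≢c′ with median (≢-sym (>⇒≢ i<c)) (≢-sym (>⇒≢ i<c′))
                            (larger-below-joined i<c i<c′ i↓c i↓c′) (unsep′ c i<c c≢c′) (unsep c′ i<c′ (≢-sym c≢c′))
  ...   | m , m≢i , n-ic , n-cc′ , n-ic′ with <-cmp m i
  ...     | tri< m<i _ _ = ⊥-elim (no-three-larger-components m<i (<-trans m<i i<c) (<-trans m<i i<c′) n-ic n-cc′ n-ic′)
  ...     | tri≈ _ m≡i _ = ⊥-elim (m≢i m≡i)
  ...     | tri> _ _ i<m with m ≟ c | m ≟ c′
  ...       | yes refl | _ = ⊥-elim (n-ic′ (unsep′ c i<c c≢c′))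
  ...       | no _ | yes refl = ⊥-elim (n-ic (unsep c′ i<c′ (≢-sym c≢c′)))
  ...       | no m≢c | no _ = ⊥-elim (n-ic (unsep m i<m m≢c))

  nearest-separates : ∀ {i c y} → NearestLargerBelow i c → i < y → Below i y → y ≢ c → ¬ Joined c i y
  nearest-separates {i} {c} {y} nc i<y i↓y y≢c with nearest-exists i<y i↓y
  ... | c′ , nc′ , inj₁ c′≡y = ⊥-elim (y≢c (trans (sym c′≡y) (sym (nearest-unique nc nc′))))
  ... | c′ , nc′ , inj₂ n = subst (λ x → ¬ Joined x i y) (sym (nearest-unique nc nc′)) n

  nearest-joined-above : ∀ {i c y} → NearestLargerBelow i c → Above i y → Joined c i y
  nearest-joined-above {i} {c} (i<c , i↓c , _ , _) (p , i⋖p , rp) with Joined-split c rp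
  ... | inj₂ (jpc , _) = ⊥-elim (below⇒¬above i↓c (p , i⋖p , jpc))
  ... | inj₁ σ = Joined-step (⋖⇒Adj i⋖p) (≢-sym (>⇒≢ i<c)) (λ { refl → below⇒¬above i↓c (p , i⋖p , ε) }) ◅◅ σ

  above-joins-below-component : ∀ {i a b w} → Below i a → Joined i a b → Above i w → Joined w a b
  above-joins-below-component i↓a r i↑w with Joined-split _ r
  ... | inj₁ σ = σ
  ... | inj₂ (α , _) = ⊥-elim (below⇒¬above (Below-joined i↓a α) i↑w)

module NearestNeighbourProperties {n D U} (P : OrientedPermutree n D U) where
  open OrientedPermutreeProperties P
  private module ʳ = OrientedPermutreeProperties (reverse-permutree P)

  NearestLargerAbove : Fin n → Fin n → Set
  NearestLargerAbove = ʳ.NearestLargerBelow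

  NearestNeighbour : Fin n → Fin n → Set
  NearestNeighbour i w = NearestLargerBelow i w ⊎ NearestLargerAbove i w

  NearestNeighbour-larger : ∀ {i w} → NearestNeighbour i w → i < w
  NearestNeighbour-larger (inj₁ (i<w , _)) = i<w
  NearestNeighbour-larger (inj₂ (i<w , _)) = i<w

  NearestNeighbour-unseparated : ∀ {i w} → NearestNeighbour i w → Unseparated i w
  NearestNeighbour-unseparated (inj₁ (_ , _ , _ , unsep)) = unsep
  NearestNeighbour-unseparated (inj₂ (_ , _ , _ , unsep)) = unsep

  private
    reroute : ∀ {i y z w} → i < z → Joined z i y → Unseparated i w → (w ≡ y ⊎ ¬ Joined w i y) →
              w ≢ z × Joined z w y
    reroute {i} {y} {z} {w} i<z r unsep w-sep with w ≟ z
    ... | no w≢z = w≢z , Joined-trans (Joined-sym (unsep z i<z (≢-sym w≢z))) r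
    ... | yes refl = ⊥-elim (case w-sep of λ where
      (inj₁ refl) → >⇒≢ i<z (sym (Joined-to-centre r))
      (inj₂ n-iy) → n-iy r)

  joined⇒via-neighbour : ∀ {i y z} → i < z → i < y → Joined z i y →
    Σ (Fin n) λ w → NearestNeighbour i w × w ≢ z × Joined z w y
  joined⇒via-neighbour i<z i<y r with below-or-above (>⇒≢ i<y)
  ... | inj₁ i↓y = let c , nc@(_ , _ , _ , unsep) , c-sep = nearest-exists i<y i↓y
                   in c , inj₁ nc , reroute i<z r unsep c-sep
  ... | inj₂ i↑y = let p , np@(_ , _ , _ , unsep) , p-sep = ʳ.nearest-exists i<y i↑y
                   in p , inj₂ np , reroute i<z r unsep p-sep

  via-neighbour⇒joined : ∀ {i y z w} → i < z → NearestNeighbour i w → w ≢ z → Joined z w y → Joined z i y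
  via-neighbour⇒joined i<z nw w≢z r = Joined-trans (NearestNeighbour-unseparated nw _ i<z (≢-sym w≢z)) r

  below⇒via-neighbour : ∀ {i x} → i < x → Below x i →
    NearestLargerAbove i x ⊎ Σ (Fin n) λ w → NearestNeighbour i w × w ≢ x × Below x w
  below⇒via-neighbour {i} {x} i<x x↓i with below-or-above (>⇒≢ i<x)
  ... | inj₁ i↓x with nearest-exists i<x i↓x
  ...   | c , nc@(_ , _ , c↑i , unsep) , _ = inj₂ (c , inj₁ nc , c≢x , Below-joined x↓i (unsep x i<x (≢-sym c≢x)))
    where
    c≢x : c ≢ x
    c≢x refl = below⇒¬above x↓i c↑i
  below⇒via-neighbour {i} {x} i<x x↓i | inj₂ i↑x with ʳ.nearest-exists i<x i↑x
  ...   | p , np@(_ , _ , _ , unsep) , _ with p ≟ x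
  ...     | yes refl = inj₁ np
  ...     | no p≢x = inj₂ (p , inj₂ np , p≢x , Below-joined x↓i (unsep x i<x (≢-sym p≢x)))

  via-neighbour⇒below : ∀ {i x} → i < x →
    NearestLargerAbove i x ⊎ (Σ (Fin n) λ w → NearestNeighbour i w × w ≢ x × Below x w) → Below x i
  via-neighbour⇒below i<x (inj₁ (_ , _ , x↓i , _)) = x↓i
  via-neighbour⇒below i<x (inj₂ (w , nw , w≢x , x↓w)) =
    Below-joined x↓w (Joined-sym (NearestNeighbour-unseparated nw _ i<x (≢-sym w≢x)))

  joined⇒same-side : ∀ {i x y} → i < x → Joined i x y → (Below i x × Below i y) ⊎ (Above i x × Above i y)
  joined⇒same-side i<x r with below-or-above (>⇒≢ i<x)
  ... | inj₁ i↓x = inj₁ (i↓x , Below-joined i↓x r)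
  ... | inj₂ i↑x = inj₂ (i↑x , Above-joined i↑x r)

countᵇ-positive : ∀ {m} (f : Fin m → Bool) {a} → f a ≡ true → 1 N.≤ countᵇ f
countᵇ-positive f {zero} fa rewrite fa = N.s≤s N.z≤n
countᵇ-positive f {suc a} fa = NP.≤-trans (countᵇ-positive (λ j → f (suc j)) fa) (NP.m≤n+m _ _)

countᵇ-two : ∀ {m} (f : Fin m → Bool) {a b} → f a ≡ true → f b ≡ true → a ≢ b → 2 N.≤ countᵇ f
countᵇ-two f {zero} {zero} _ _ a≢b = ⊥-elim (a≢b refl)
countᵇ-two f {zero} {suc b} fa fb _ rewrite fa = N.s≤s (countᵇ-positive (λ j → f (suc j)) fb)
countᵇ-two f {suc a} {zero} fa fb _ rewrite fb = N.s≤s (countᵇ-positive (λ j → f (suc j)) fa)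
countᵇ-two f {suc a} {suc b} fa fb a≢b =
  NP.≤-trans (countᵇ-two (λ j → f (suc j)) fa fb (λ e → a≢b (cong suc e))) (NP.m≤n+m _ _)

TwoChildren TwoParents : ∀ {n} → (Fin n → Decoration) → Fin n → Set
TwoChildren δ z = childSlots (δ z) ≡ 2
TwoParents δ z = parentSlots (δ z) ≡ 2

module SeparatedNeighbours {n : ℕ} (E : Digraph n) (isTree : IsTree E)
  (Nbr : Fin n → Fin n → Set) (Two : Fin n → Set)
  (two : ∀ {c c′ z} → Nbr z c → Nbr z c′ → c ≢ c′ → Two z)
  (separated : ∀ z → Two z → Separated E z (Nbr z)) where
  open TreeProperties E isTree

  Side : Fin n → Fin n → Set
  Side z y = Σ (Fin n) λ c → Nbr z c × Joined z c y

  larger-joined : ∀ {z x y} → z < x → z < y → Side z x → Side z y → Joined z x y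
  larger-joined {z} {x} {y} z<x z<y (cx , nx , rx) (cy , ny , ry) with cx ≟ cy
  ... | yes refl = Joined-trans (Joined-sym rx) ry
  ... | no cx≢cy with separated z (two nx ny cx≢cy)
  ...   | (sides , _ , ¬right²) with sides cx nx | sides cy ny
  ...     | inj₁ left | _ = ⊥-elim (<-asym (left x rx) z<x)
  ...     | inj₂ _ | inj₁ left = ⊥-elim (<-asym (left y ry) z<y)
  ...     | inj₂ rightx | inj₂ righty = ⊥-elim (¬right² cx cy nx ny cx≢cy (rightx , righty))

  split : ∀ {i x a b} → i < x → Side x a → Side x b → ¬ Joined x a b → Joined x i a → a < x × x < b × Two x
  split {i} {x} {a} {b} i<x (ca , na , ra) (cb , nb , rb) n-ab jia with ca ≟ cb
  ... | yes refl = ⊥-elim (n-ab (Joined-trans (Joined-sym ra) rb))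
  ... | no ca≢cb with separated x (two na nb ca≢cb)
  ...   | (sides , ¬left² , _) with sides ca na
  ...     | inj₂ righta = ⊥-elim (<-asym (righta i (Joined-trans ra (Joined-sym jia))) i<x)
  ...     | inj₁ lefta with sides cb nb
  ...       | inj₁ leftb = ⊥-elim (¬left² ca cb na nb ca≢cb (lefta , leftb))
  ...       | inj₂ rightb = lefta a ra , rightb b rb , two na nb ca≢cb

  straddle : ∀ {i x a} → Two x → Side x a → Joined x i a → i < x → ¬ x < a
  straddle {i} {x} {a} t (ca , na , ra) jia i<x x<a with separated x t
  ... | (sides , _ , _) with sides ca na
  ...   | inj₁ left = <-asym (left a ra) x<a
  ...   | inj₂ right = <-asym (right i (Joined-trans ra (Joined-sym jia))) i<x

module _ {n : ℕ} {E : Digraph n} {δ : Fin n → Decoration} (pt : IsPermutree E δ) where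
  private
    isTree = proj₁ pt
    local = proj₂ pt
    open TreeProperties E isTree

    two≰one : ∀ {k} → 2 N.≤ k → ¬ k N.≤ 1
    two≰one 2≤k k≤1 = NP.<-irrefl refl (NP.≤-trans 2≤k k≤1)

    two-children : ∀ {c c′ z} → Child E z c → Child E z c′ → c ≢ c′ → TwoChildren δ z
    two-children {c} {c′} {z} e e′ c≢c′ with δ z | local z
    ... | none   | (_ , bound , _) = ⊥-elim (two≰one (countᵇ-two (λ q → E q z) e e′ c≢c′) bound)
    ... | up     | (_ , bound , _) = ⊥-elim (two≰one (countᵇ-two (λ q → E q z) e e′ c≢c′) bound)
    ... | down   | _ = refl
    ... | updown | _ = refl

    two-parents : ∀ {p p′ z} → Parent E z p → Parent E z p′ → p ≢ p′ → TwoParents δ z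
    two-parents {p} {p′} {z} e e′ p≢p′ with δ z | local z
    ... | none   | (bound , _) = ⊥-elim (two≰one (countᵇ-two (λ q → E z q) e e′ p≢p′) bound)
    ... | down   | (bound , _) = ⊥-elim (two≰one (countᵇ-two (λ q → E z q) e e′ p≢p′) bound)
    ... | up     | _ = refl
    ... | updown | _ = refl

    children-separated : ∀ z → TwoChildren δ z → Separated E z (Child E z)
    children-separated z two with δ z | local z
    ... | down   | (_ , _ , _ , sep) = sep
    ... | updown | (_ , _ , _ , sep) = sep
    children-separated z () | none | _
    children-separated z () | up | _

    parents-separated : ∀ z → TwoParents δ z → Separated E z (Parent E z)
    parents-separated z two with δ z | local z
    ... | up     | (_ , _ , sep , _) = sep
    ... | updown | (_ , _ , sep , _) = sep
    parents-separated z () | none | _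
    parents-separated z () | down | _

    module Children = SeparatedNeighbours E isTree (Child E) (TwoChildren δ) two-children children-separated
    module Parents = SeparatedNeighbours E isTree (Parent E) (TwoParents δ) two-parents parents-separated

  childOrientation : OrientedPermutree n (TwoChildren δ) (TwoParents δ)
  childOrientation = record
    { tree = record
      { E = E ; isTree = isTree ; _⋖_ = Edge E
      ; ⋖⇒Adj = inj₁ ; Adj⇒⋖ = λ a → a ; ⋖-asym = λ {x} {y} → proj₁ (proj₂ isTree) x y }
    ; larger-below-joined = Children.larger-joined ; larger-above-joined = Parents.larger-joined
    ; below-split = Children.split ; above-split = Parents.split
    ; below-straddle = Children.straddle ; above-straddle = Parents.straddle }

module _ {n : ℕ} {E : Digraph n} {δ : Fin n → Decoration} (pt : IsPermutree E δ) where
  open OrientedPermutree (childOrientation pt) using (Below)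

  -- a descendant of i larger than i cannot lie in its left descendant subtree
  larger-below⇔cubic : ∀ {i j} → (i < j × Below i j) ⇔ CubicComponent E δ i j
  larger-below⇔cubic {i} {j} = mk⇔ (λ (i<j , i↓j) → i<j , to i<j i↓j) (λ (i<j , side) → i<j , from (δ i) side)
    where
    from : ∀ d → DescSide E d i j → Below i j
    from none (c , ch , r) = c , ch , r
    from up (c , ch , r) = c , ch , r
    from down (c , ch , _ , r) = c , ch , r
    from updown (c , ch , _ , r) = c , ch , r
    to : i < j → Below i j → DescSide E (δ i) i j
    to i<j (c , ch , r) with δ i | proj₂ pt i
    ... | none | _ = c , ch , r
    ... | up | _ = c , ch , r
    ... | down | (_ , _ , _ , sides , _) = case sides c ch of λ where
      (inj₁ left) → ⊥-elim (<-asym (left j r) i<j)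
      (inj₂ right) → c , ch , right , r
    ... | updown | (_ , _ , _ , sides , _) = case sides c ch of λ where
      (inj₁ left) → ⊥-elim (<-asym (left j r) i<j)
      (inj₂ right) → c , ch , right , r

module _ {A : Set} (eq? : DecidableEquality A) where
  delete : A → List A → List A
  delete x [] = []
  delete x (y ∷ ys) with eq? x y
  ... | yes _ = ys
  ... | no _ = y ∷ delete x ys

  length-delete : ∀ {x ys} → x ∈ ys → suc (length (delete x ys)) ≡ length ys
  length-delete {x} {y ∷ ys} x∈ with eq? x y
  length-delete {x} {y ∷ ys} x∈ | yes _ = refl
  length-delete {x} {y ∷ ys} (here x≡y) | no x≢y = ⊥-elim (x≢y x≡y)
  length-delete {x} {y ∷ ys} (there x∈) | no _ = cong suc (length-delete x∈)

  ∈-delete : ∀ {x y ys} → y ∈ ys → y ≢ x → y ∈ delete x ys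
  ∈-delete {x} {y} {z ∷ ys} y∈ y≢x with eq? x z
  ∈-delete (here y≡z) y≢x | yes x≡z = ⊥-elim (y≢x (trans y≡z (sym x≡z)))
  ∈-delete (there y∈) y≢x | yes _ = y∈
  ∈-delete (here y≡z) y≢x | no _ = here y≡z
  ∈-delete (there y∈) y≢x | no _ = there (∈-delete y∈ y≢x)

  Unique-⊆⇒length-≤ : ∀ {xs ys} → Unique xs → xs ⊆ ys → length xs N.≤ length ys
  Unique-⊆⇒length-≤ {[]} _ _ = N.z≤n
  Unique-⊆⇒length-≤ {x ∷ xs} (x∉xs ∷ uxs) xs⊆ys =
    subst (suc (length xs) N.≤_) (length-delete (xs⊆ys (here refl)))
      (N.s≤s (Unique-⊆⇒length-≤ uxs λ y∈ → ∈-delete (xs⊆ys (there y∈)) (λ y≡x → All.lookup x∉xs y∈ (sym y≡x))))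

  Unique-⊂⇒length-< : ∀ {xs ys j} → Unique xs → xs ⊆ ys → j ∈ ys → j ∉ xs → length xs N.< length ys
  Unique-⊂⇒length-< {xs} {ys} {j} uxs xs⊆ys j∈ys j∉xs =
    subst (length xs N.<_) (length-delete j∈ys)
      (N.s≤s (Unique-⊆⇒length-≤ uxs λ y∈ → ∈-delete (xs⊆ys y∈) λ { refl → j∉xs y∈ }))

CardIs-exchange : ∀ {n k} {P Q : Fin n → Set} → Decidable P → CardIs P k → CardIs Q k →
  ∀ {j} → P j → ¬ Q j → ∃ λ y → Q y × ¬ P y
CardIs-exchange P? (xs , _ , P⇔ , refl) (ys , uys , Q⇔ , |ys|≡|xs|) {j} Pj ¬Qj with all? P? ys
... | no ¬all = let y , y∈ys , ¬Py = find (¬All⇒Any¬ P? ys ¬all) in y , Equivalence.from (Q⇔ y) y∈ys , ¬Py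
... | yes all = ⊥-elim (NP.<-irrefl |ys|≡|xs|
      (Unique-⊂⇒length-< _≟_ uys (λ y∈ → Equivalence.to (P⇔ _) (All.lookup all y∈))
        (Equivalence.to (P⇔ j) Pj) (λ j∈ys → ¬Qj (Equivalence.from (Q⇔ j) j∈ys))))

record Agree {n : ℕ} (T₁ T₂ : OrientedTree n) (t : ℕ) : Set where
  field
    joined : ∀ {z x y} → t N.≤ toℕ z → t N.≤ toℕ x → t N.≤ toℕ y →
             ReachAvoiding (OrientedTree.E T₁) z x y → ReachAvoiding (OrientedTree.E T₂) z x y
    below : ∀ {x y} → t N.≤ toℕ x → t N.≤ toℕ y → OrientedTree.Below T₁ x y → OrientedTree.Below T₂ x y

Agree-reverse : ∀ {n} {T₁ T₂ : OrientedTree n} {t} → Agree T₁ T₂ t → Agree T₂ T₁ t → Agree (reverse T₁) (reverse T₂) t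
Agree-reverse {T₁ = T₁} {T₂} a₁₂ a₂₁ = record
  { joined = Agree.joined a₁₂
  ; below = λ tx ty x↑y → ₂.¬below⇒above (₁.Above⇒≢ x↑y) λ x↓y → ₁.below⇒¬above (Agree.below a₂₁ tx ty x↓y) x↑y }
  where module ₁ = OrientedTreeProperties T₁
        module ₂ = OrientedTreeProperties T₂

AgreeAbove : ∀ {n D U} → OrientedPermutree n D U → OrientedPermutree n D U → Fin n → Set
AgreeAbove P₁ P₂ i = Agree (OrientedPermutree.tree P₁) (OrientedPermutree.tree P₂) (suc (toℕ i))

Agree-beyond : ∀ {n} {T₁ T₂ : OrientedTree n} → Agree T₁ T₂ n
Agree-beyond = record { joined = λ n≤z _ _ _ → ⊥-elim (beyond n≤z) ; below = λ n≤x _ _ → ⊥-elim (beyond n≤x) }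
  where
  beyond : ∀ {n} {v : Fin n} → ¬ n N.≤ toℕ v
  beyond {v = v} = NP.<⇒≱ (toℕ<n v)

-- if x ⋖₁ y but y's lower neighbour towards x in the second tree were some c ≢ x, then c would separate x from y
Agree-everywhere⇒⋖ : ∀ {n} {T₁ T₂ : OrientedTree n} → Agree T₁ T₂ 0 →
  ∀ {x y} → OrientedTree._⋖_ T₁ x y → OrientedTree._⋖_ T₂ x y
Agree-everywhere⇒⋖ {T₁ = T₁} {T₂} agree {x} {y} x⋖y with Agree.below agree N.z≤n N.z≤n (x , x⋖y , ε)
... | c , c⋖₂y , r with c ≟ x
...   | yes refl = c⋖₂y
...   | no c≢x = ⊥-elim (₂.neighbour-separates (₂.Adj-sym (₂.⋖⇒Adj c⋖₂y)) r
          (Agree.joined agree N.z≤n N.z≤n N.z≤n (₁.Joined-step (₁.⋖⇒Adj x⋖y) (≢-sym c≢x) y≢c)))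
  where
  module ₁ = OrientedTreeProperties T₁
  module ₂ = OrientedTreeProperties T₂
  y≢c : y ≢ c
  y≢c refl = ₂.⋖-asym c⋖₂y c⋖₂y

module NearestComparison {n D U} (P₁ P₂ : OrientedPermutree n D U) (i : Fin n)
  (agree₁₂ : AgreeAbove P₁ P₂ i) (agree₂₁ : AgreeAbove P₂ P₁ i) where
  module ₁ = OrientedPermutreeProperties P₁
  module ₂ = OrientedPermutreeProperties P₂

  joined₁₂ : ∀ {z x y} → i < z → i < x → i < y → ₁.Joined z x y → ₂.Joined z x y
  joined₁₂ = Agree.joined agree₁₂

  joined₂₁ : ∀ {z x y} → i < z → i < x → i < y → ₂.Joined z x y → ₁.Joined z x y
  joined₂₁ = Agree.joined agree₂₁

  below₁₂ : ∀ {x y} → i < x → i < y → ₁.Below x y → ₂.Below x y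
  below₁₂ = Agree.below agree₁₂

  below₂₁ : ∀ {x y} → i < x → i < y → ₂.Below x y → ₁.Below x y
  below₂₁ = Agree.below agree₂₁

  above₁₂ : ∀ {x y} → i < x → i < y → ₁.Above x y → ₂.Above x y
  above₁₂ = Agree.below (Agree-reverse agree₁₂ agree₂₁)

  -- a peak x above i would order c₁ < x < c₂ in the first tree but c₂ < x in the second
  nearest-no-peak : ∀ {c₁ c₂} → ₁.NearestLargerBelow i c₁ → ₂.NearestLargerBelow i c₂ →
                    ₁.Above c₁ c₂ → ¬ ₁.Above c₂ c₁
  nearest-no-peak {c₁} {c₂} (i<c₁ , i↓c₁ , _ , unsep₁) (i<c₂ , _ , _ , unsep₂) c₁↑c₂ c₂↑c₁
    with ₁.peak c₁↑c₂ c₂↑c₁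
  ... | x , x↓c₁ , x↓c₂ , n-c₁c₂ with <-cmp x i
  ...   | tri< x<i _ _ = n-c₁c₂ (₁.larger-below-joined (<-trans x<i i<c₁) (<-trans x<i i<c₂) x↓c₁ x↓c₂)
  ...   | tri≈ _ refl _ = n-c₁c₂ (₁.larger-below-joined i<c₁ i<c₂ i↓c₁ x↓c₂)
  ...   | tri> _ _ i<x
    with ₁.below-split i<x x↓c₁ x↓c₂ n-c₁c₂ (unsep₁ x i<x (≢-sym (₁.Below⇒≢ x↓c₁)))
       | ₂.below-split i<x (below₁₂ i<x i<c₂ x↓c₂) (below₁₂ i<x i<c₁ x↓c₁)
           (λ j → n-c₁c₂ (₁.Joined-sym (joined₂₁ i<x i<c₂ i<c₁ j))) (unsep₂ x i<x (≢-sym (₁.Below⇒≢ x↓c₂)))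
  ... | _ , x<c₂ , _ | c₂<x , _ , _ = <-asym x<c₂ c₂<x

  nearest-no-valley : ∀ {c₁ c₂} → ₁.NearestLargerBelow i c₁ → ₂.NearestLargerBelow i c₂ →
                      ₁.Below c₁ c₂ → ¬ ₁.Below c₂ c₁
  nearest-no-valley {c₁} {c₂} (i<c₁ , i↓c₁ , _ , unsep₁) (i<c₂ , _ , _ , unsep₂) c₁↓c₂ c₂↓c₁
    with ₁.valley c₁↓c₂ c₂↓c₁
  ... | x , x↑c₁ , x↑c₂ , n-c₁c₂ with <-cmp x i
  ...   | tri< x<i _ _ = n-c₁c₂ (₁.larger-above-joined (<-trans x<i i<c₁) (<-trans x<i i<c₂) x↑c₁ x↑c₂)
  ...   | tri≈ _ refl _ = ₁.below⇒¬above i↓c₁ x↑c₁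
  ...   | tri> _ _ i<x
    with ₁.above-split i<x x↑c₁ x↑c₂ n-c₁c₂ (unsep₁ x i<x (≢-sym (₁.Above⇒≢ x↑c₁)))
       | ₂.above-split i<x (above₁₂ i<x i<c₂ x↑c₂) (above₁₂ i<x i<c₁ x↑c₁)
           (λ j → n-c₁c₂ (₁.Joined-sym (joined₂₁ i<x i<c₂ i<c₁ j))) (unsep₂ x i<x (≢-sym (₁.Above⇒≢ x↑c₂)))
  ... | _ , x<c₂ , _ | c₂<x , _ , _ = <-asym x<c₂ c₂<x

  -- c₁ would have two parents with i and c₂ on different sides, yet the second tree joins them at c₁
  nearest-separating-not-above : ∀ {c₁ c₂} → ₁.NearestLargerBelow i c₁ → ₂.NearestLargerBelow i c₂ →
    c₁ ≢ c₂ → ¬ ₁.Joined c₁ i c₂ → ¬ ₁.Above c₁ c₂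
  nearest-separating-not-above {c₁} {c₂} (i<c₁ , _ , c₁↑i , _) (i<c₂ , _ , _ , unsep₂) c₁≢c₂ n-ic₂ c₁↑c₂
    with ₁.above-split i<c₁ c₁↑i c₁↑c₂ n-ic₂ ε
  ... | _ , c₁<c₂ , two = ₂.above-straddle two (above₁₂ i<c₁ i<c₂ c₁↑c₂) (unsep₂ c₁ i<c₁ c₁≢c₂) i<c₁ c₁<c₂

  -- in the second tree no vertex above i separates a from b, in the first c₁ does unless c₁ ≡ a
  nearest-between-unseparated : ∀ {c₁ a b} → ₁.NearestLargerBelow i c₁ →
    i < a → ₁.Below i a → i < b → ₁.Above i b → ₂.Unseparated i a → ₂.Unseparated i b → c₁ ≡ a
  nearest-between-unseparated {c₁} {a} {b} nc₁@(i<c₁ , i↓c₁ , _ , _) i<a i↓a i<b i↑b unsep-a unsep-b with c₁ ≟ a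
  ... | yes c₁≡a = c₁≡a
  ... | no c₁≢a = ⊥-elim (n-ab₂ (₂.Joined-trans (₂.Joined-sym (unsep-a c₁ i<c₁ c₁≢a)) (unsep-b c₁ i<c₁ c₁≢b)))
    where
    c₁≢b : c₁ ≢ b
    c₁≢b refl = ₁.below⇒¬above i↓c₁ i↑b
    n-ab₁ : ¬ ₁.Joined c₁ a b
    n-ab₁ j = ₁.nearest-separates nc₁ i<a i↓a (≢-sym c₁≢a) (₁.Joined-trans (₁.nearest-joined-above nc₁ i↑b) (₁.Joined-sym j))
    n-ab₂ : ¬ ₂.Joined c₁ a b
    n-ab₂ j = n-ab₁ (joined₂₁ i<c₁ i<a i<b j)

  module ₂ʳ = OrientedPermutreeProperties (reverse-permutree P₂)

  Switches : Fin n → Set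
  Switches j = i < j × ₁.Below i j × ₂.Above i j

  no-switch-with-common-nearest : ∀ {c p j} → ₁.NearestLargerBelow i c → ₂.NearestLargerBelow i c →
    i < p → ₁.Above i p → ₁.Unseparated i p → ₂.Unseparated i p → ¬ Switches j
  no-switch-with-common-nearest {c} {p} {j} nc₁@(i<c , i↓c , _ , _) nc₂@(_ , i↓₂c , _ , _) i<p i↑p unsep₁ unsep₂
    (i<j , i↓j , i↑₂j) with j ≟ c
  ... | yes refl = ₂.below⇒¬above i↓₂c i↑₂j
  ... | no j≢c = n-pj₁ (joined₂₁ i<c i<p i<j (₂.Joined-trans (₂.Joined-sym (unsep₂ c i<c c≢p)) (₂.nearest-joined-above nc₂ i↑₂j)))
    where
    c≢p : c ≢ p
    c≢p refl = ₁.below⇒¬above i↓c i↑p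
    n-pj₁ : ¬ ₁.Joined c p j
    n-pj₁ r = ₁.nearest-separates nc₁ i<j i↓j j≢c (₁.Joined-trans (unsep₁ c i<c c≢p) r)

  no-switch-with-crossed-nearest : ∀ {c₁ p₂ j} → ₁.NearestLargerBelow i c₁ → ₂ʳ.NearestLargerBelow i p₂ →
    ₂.Below i c₁ → ₁.Above i p₂ → ¬ Switches j
  no-switch-with-crossed-nearest {c₁} {p₂} {j} (i<c₁ , i↓c₁ , _ , _) np₂@(i<p₂ , _ , _ , _) i↓₂c₁ i↑p₂
    (i<j , i↓j , i↑₂j) with j ≟ p₂
  ... | yes refl = ₁.below⇒¬above i↓j i↑p₂
  ... | no j≢p₂ = n-c₁j₂ (joined₁₂ i<p₂ i<c₁ i<j (₁.above-joins-below-component i↓c₁ (₁.larger-below-joined i<c₁ i<j i↓c₁ i↓j) i↑p₂))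
    where
    n-c₁j₂ : ¬ ₂.Joined p₂ c₁ j
    n-c₁j₂ r = ₂ʳ.nearest-separates np₂ i<j i↑₂j j≢p₂ (₂.Joined-trans (₂ʳ.nearest-joined-above np₂ i↓₂c₁) r)

module NearestAgreement {n D U} (P₁ P₂ : OrientedPermutree n D U) (i : Fin n)
  (agree₁₂ : AgreeAbove P₁ P₂ i) (agree₂₁ : AgreeAbove P₂ P₁ i) where
  open NearestComparison P₁ P₂ i agree₁₂ agree₂₁ using (module ₁; module ₂; nearest-no-valley; nearest-separating-not-above; above₁₂)
  private module C₂₁ = NearestComparison P₂ P₁ i agree₂₁ agree₁₂

  nearest-agree : ∀ {c₁ c₂} → ₁.NearestLargerBelow i c₁ → ₂.NearestLargerBelow i c₂ →
    ₁.Below i c₂ → ₂.Below i c₁ → c₁ ≡ c₂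
  nearest-agree {c₁} {c₂} nc₁@(i<c₁ , _ , _ , _) nc₂@(i<c₂ , _ , _ , _) i↓c₂ i↓₂c₁ with c₁ ≟ c₂
  ... | yes c₁≡c₂ = c₁≡c₂
  ... | no c₁≢c₂ with ₁.below-or-above {c₁} {c₂} (≢-sym c₁≢c₂)
  ...   | inj₂ c₁↑c₂ =
          ⊥-elim (nearest-separating-not-above nc₁ nc₂ c₁≢c₂ (₁.nearest-separates nc₁ i<c₂ i↓c₂ (≢-sym c₁≢c₂)) c₁↑c₂)
  ...   | inj₁ c₁↓c₂ with ₁.below-or-above {c₂} {c₁} c₁≢c₂
  ...     | inj₁ c₂↓c₁ = ⊥-elim (nearest-no-valley nc₁ nc₂ c₁↓c₂ c₂↓c₁)
  ...     | inj₂ c₂↑c₁ = ⊥-elim (C₂₁.nearest-separating-not-above nc₂ nc₁ (≢-sym c₁≢c₂)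
                             (₂.nearest-separates nc₂ i<c₁ i↓₂c₁ c₁≢c₂) (above₁₂ i<c₂ i<c₁ c₂↑c₁))

module NeighbourPositions {n D U} (P₁ P₂ : OrientedPermutree n D U) (i : Fin n)
  (agree₁₂ : AgreeAbove P₁ P₂ i) (agree₂₁ : AgreeAbove P₂ P₁ i) where
  module C = NearestComparison P₁ P₂ i agree₁₂ agree₂₁
  module Cʳ = NearestComparison (reverse-permutree P₁) (reverse-permutree P₂) i
                (Agree-reverse agree₁₂ agree₂₁) (Agree-reverse agree₂₁ agree₁₂)
  open C using (module ₁; module ₂; module ₂ʳ; Switches) public
  module ₁ʳ = OrientedPermutreeProperties (reverse-permutree P₁)

  nearest-below-agree : ∀ {c₁ c₂} → ₁.NearestLargerBelow i c₁ → ₂.NearestLargerBelow i c₂ →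
    ₁.Below i c₂ → ₂.Below i c₁ → c₁ ≡ c₂
  nearest-below-agree = NearestAgreement.nearest-agree P₁ P₂ i agree₁₂ agree₂₁

  nearest-above-agree : ∀ {p₁ p₂} → ₁ʳ.NearestLargerBelow i p₁ → ₂ʳ.NearestLargerBelow i p₂ →
    ₁.Above i p₂ → ₂.Above i p₁ → p₁ ≡ p₂
  nearest-above-agree = NearestAgreement.nearest-agree (reverse-permutree P₁) (reverse-permutree P₂) i
                          (Agree-reverse agree₁₂ agree₂₁) (Agree-reverse agree₂₁ agree₁₂)

  nearest-not-crossed : ∀ {c₁ p₁ c₂ p₂} → ₁.NearestLargerBelow i c₁ → ₁ʳ.NearestLargerBelow i p₁ →
    ₂.NearestLargerBelow i c₂ → ₂ʳ.NearestLargerBelow i p₂ → ₁.Above i c₂ → ¬ ₁.Below i p₂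
  nearest-not-crossed {c₁} {p₁} {c₂} {p₂} nc₁@(i<c₁ , i↓c₁ , c₁↑i , _) np₁@(i<p₁ , i↑p₁ , p₁↓i , unsep-p₁)
    nc₂@(i<c₂ , i↓₂c₂ , _ , unsep-c₂) np₂@(i<p₂ , i↑₂p₂ , p₂↓₂i , unsep-p₂) i↑c₂ i↓p₂ =
    ₁.below⇒¬above (C.below₂₁ i<c₁ i<p₁ c₁↓₂p₁) c₁↑p₁
    where
    c₁≡p₂ : c₁ ≡ p₂
    c₁≡p₂ = C.nearest-between-unseparated nc₁ i<p₂ i↓p₂ i<c₂ i↑c₂ unsep-p₂ unsep-c₂
    p₁≡c₂ : p₁ ≡ c₂
    p₁≡c₂ = Cʳ.nearest-between-unseparated np₁ i<c₂ i↑c₂ i<p₂ i↓p₂ unsep-c₂ unsep-p₂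
    c₁↑p₁ : ₁.Above c₁ p₁
    c₁↑p₁ = ₁.Above-joined c₁↑i (unsep-p₁ c₁ i<c₁ λ { refl → ₁.below⇒¬above i↓c₁ i↑p₁ })
    p₂↓₂c₂ : ₂.Below p₂ c₂
    p₂↓₂c₂ = ₂.Below-joined p₂↓₂i (unsep-c₂ p₂ i<p₂ λ { refl → ₂.below⇒¬above i↓₂c₂ i↑₂p₂ })
    c₁↓₂p₁ : ₂.Below c₁ p₁
    c₁↓₂p₁ = subst₂ ₂.Below (sym c₁≡p₂) (sym p₁≡c₂) p₂↓₂c₂

  switch⇒nearest-not-kept : ∀ {j c₁ p₁ c₂ p₂} → Switches j → ₁.NearestLargerBelow i c₁ → ₁ʳ.NearestLargerBelow i p₁ →
    ₂.NearestLargerBelow i c₂ → ₂ʳ.NearestLargerBelow i p₂ → ₁.Below i c₂ → ¬ ₁.Above i p₂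
  switch⇒nearest-not-kept switch nc₁ np₁@(i<p₁ , i↑p₁ , _ , unsep-p₁) nc₂@(i<c₂ , _ , _ , unsep-c₂)
    np₂@(i<p₂ , _ , _ , unsep-p₂) i↓c₂ i↑p₂ =
    C.no-switch-with-common-nearest nc₁ (subst (₂.NearestLargerBelow i) (sym c₁≡c₂) nc₂) i<p₁ i↑p₁ unsep-p₁
      (subst (₂.Unseparated i) (sym p₁≡p₂) unsep-p₂) switch
    where
    c₁≡c₂ = C.nearest-between-unseparated nc₁ i<c₂ i↓c₂ i<p₂ i↑p₂ unsep-c₂ unsep-p₂
    p₁≡p₂ = Cʳ.nearest-between-unseparated np₁ i<p₂ i↑p₂ i<c₂ i↓c₂ unsep-p₂ unsep-c₂

module Exchange {n D U} (P₁ P₂ : OrientedPermutree n D U) (i : Fin n)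
  (agree₁₂ : AgreeAbove P₁ P₂ i) (agree₂₁ : AgreeAbove P₂ P₁ i) where
  module X = NeighbourPositions P₁ P₂ i agree₁₂ agree₂₁
  module Y = NeighbourPositions P₂ P₁ i agree₂₁ agree₁₂
  open X using (module ₁; module ₂; module ₁ʳ; module ₂ʳ)

  -- locate each tree's nearest neighbours of i in the other tree; every configuration is contradictory
  no-exchange : ∀ {j k} → X.Switches j → Y.Switches k → ⊥
  no-exchange sj@(i<j , i↓j , i↑₂j) sk@(i<k , i↓₂k , i↑k)
    with ₁.nearest-exists i<j i↓j | ₁ʳ.nearest-exists i<k i↑k | ₂.nearest-exists i<k i↓₂k | ₂ʳ.nearest-exists i<j i↑₂j
  ... | c₁ , nc₁@(i<c₁ , _ , c₁↑i , _) , _ | p₁ , np₁@(i<p₁ , _ , p₁↓i , _) , _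
      | c₂ , nc₂@(i<c₂ , _ , c₂↑₂i , _) , _ | p₂ , np₂@(i<p₂ , _ , p₂↓₂i , _) , _
    with ₁.below-or-above (>⇒≢ i<c₂) | ₁.below-or-above (>⇒≢ i<p₂)
       | ₂.below-or-above (>⇒≢ i<c₁) | ₂.below-or-above (>⇒≢ i<p₁)
  ... | inj₁ i↓c₂ | inj₂ i↑p₂ | _ | _ = X.switch⇒nearest-not-kept sj nc₁ np₁ nc₂ np₂ i↓c₂ i↑p₂
  ... | inj₂ i↑c₂ | inj₁ i↓p₂ | _ | _ = X.nearest-not-crossed nc₁ np₁ nc₂ np₂ i↑c₂ i↓p₂
  ... | inj₁ _ | inj₁ _ | inj₁ i↓c₁ | inj₂ i↑p₁ = Y.switch⇒nearest-not-kept sk nc₂ np₂ nc₁ np₁ i↓c₁ i↑p₁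
  ... | inj₁ _ | inj₁ _ | inj₂ i↑c₁ | inj₁ i↓p₁ = Y.nearest-not-crossed nc₂ np₂ nc₁ np₁ i↑c₁ i↓p₁
  ... | inj₂ _ | inj₂ _ | inj₁ i↓c₁ | inj₂ i↑p₁ = Y.switch⇒nearest-not-kept sk nc₂ np₂ nc₁ np₁ i↓c₁ i↑p₁
  ... | inj₂ _ | inj₂ _ | inj₂ i↑c₁ | inj₁ i↓p₁ = Y.nearest-not-crossed nc₂ np₂ nc₁ np₁ i↑c₁ i↓p₁
  ... | inj₂ i↑c₂ | inj₂ _ | inj₂ i↑₂c₁ | inj₂ _ =
        X.C.nearest-no-peak nc₁ nc₂ (₁.Above-joined c₁↑i (₁.nearest-joined-above nc₁ i↑c₂))
          (Y.C.above₁₂ i<c₂ i<c₁ (₂.Above-joined c₂↑₂i (₂.nearest-joined-above nc₂ i↑₂c₁)))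
  ... | inj₁ _ | inj₁ i↓p₂ | inj₁ _ | inj₁ i↓₂p₁ =
        X.Cʳ.nearest-no-peak np₁ np₂ (₁.Below-joined p₁↓i (₁ʳ.nearest-joined-above np₁ i↓p₂))
          (Y.Cʳ.above₁₂ i<p₂ i<p₁ (₂.Below-joined p₂↓₂i (₂ʳ.nearest-joined-above np₂ i↓₂p₁)))
  ... | inj₂ _ | inj₂ i↑p₂ | inj₁ i↓₂c₁ | inj₁ _ = X.C.no-switch-with-crossed-nearest nc₁ np₂ i↓₂c₁ i↑p₂ sj
  ... | inj₁ i↓c₂ | inj₁ _ | inj₂ _ | inj₂ i↑₂p₁ = Y.C.no-switch-with-crossed-nearest nc₂ np₁ i↓c₂ i↑₂p₁ sk

ChildTree : ∀ {n} {E : Digraph n} {δ} → IsPermutree E δ → OrientedTree n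
ChildTree pt = OrientedPermutree.tree (childOrientation pt)

CubicSizesAgree : ∀ {n} → (Fin n → Decoration) → Digraph n → Digraph n → Fin n → Set
CubicSizesAgree {n} δ E₁ E₂ i =
  suc (toℕ i) N.< n → ∃ λ k → CardIs (CubicComponent E₁ δ i) k × CardIs (CubicComponent E₂ δ i) k

module Insertion {n : ℕ} {δ : Fin n → Decoration} {E₁ E₂ : Digraph n}
  (pt₁ : IsPermutree E₁ δ) (pt₂ : IsPermutree E₂ δ) (i : Fin n)
  (agree₁₂ : AgreeAbove (childOrientation pt₁) (childOrientation pt₂) i)
  (agree₂₁ : AgreeAbove (childOrientation pt₂) (childOrientation pt₁) i) where
  open Exchange (childOrientation pt₁) (childOrientation pt₂) i agree₁₂ agree₂₁ using (no-exchange)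
  module ₁ = OrientedPermutreeProperties (childOrientation pt₁)
  module ₂ = OrientedPermutreeProperties (childOrientation pt₂)

  -- a vertex j leaving the cubic component forces, by equal sizes, a vertex k entering it
  below-preserved : CubicSizesAgree δ E₁ E₂ i → ∀ {j} → i < j → ₁.Below i j → ₂.Below i j
  below-preserved sizes {j} i<j i↓j with ₂.below-or-above (>⇒≢ i<j)
  ... | inj₁ i↓₂j = i↓₂j
  ... | inj₂ i↑₂j with sizes (NP.<-≤-trans (N.s≤s i<j) (toℕ<n j))
  ...   | _ , size₁ , size₂ with CardIs-exchange cubic₁? size₁ size₂
                                  (Equivalence.to (larger-below⇔cubic pt₁) (i<j , i↓j))
                                  (λ c → ₂.below⇒¬above (proj₂ (Equivalence.from (larger-below⇔cubic pt₂) c)) i↑₂j)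
    where
    cubic₁? : Decidable (CubicComponent E₁ δ i)
    cubic₁? y = Dec.map (larger-below⇔cubic pt₁) ((i <? y) ×-dec ₁.Below? i y)
  ...     | k , k∈₂ , k∉₁ with Equivalence.from (larger-below⇔cubic pt₂) k∈₂
  ...       | i<k , i↓₂k = ⊥-elim (no-exchange (i<j , i↓j , i↑₂j)
                (i<k , i↓₂k , ₁.¬below⇒above (>⇒≢ i<k) λ i↓k → k∉₁ (Equivalence.to (larger-below⇔cubic pt₁) (i<k , i↓k))))

module Descent {n : ℕ} {δ : Fin n → Decoration} {E₁ E₂ : Digraph n}
  (pt₁ : IsPermutree E₁ δ) (pt₂ : IsPermutree E₂ δ) (i : Fin n)
  (agree₁₂ : AgreeAbove (childOrientation pt₁) (childOrientation pt₂) i)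
  (agree₂₁ : AgreeAbove (childOrientation pt₂) (childOrientation pt₁) i)
  (sizes₁₂ : CubicSizesAgree δ E₁ E₂ i) (sizes₂₁ : CubicSizesAgree δ E₂ E₁ i) where
  open NeighbourPositions (childOrientation pt₁) (childOrientation pt₂) i agree₁₂ agree₂₁
    using (module ₁; module ₂; module ₂ʳ; nearest-below-agree; nearest-above-agree)
  module N₁ = NearestNeighbourProperties (childOrientation pt₁)
  module N₂ = NearestNeighbourProperties (childOrientation pt₂)
  open NearestComparison (childOrientation pt₁) (childOrientation pt₂) i agree₁₂ agree₂₁
    using (joined₁₂; below₁₂)

  below₁₂-at-i : ∀ {j} → i < j → ₁.Below i j → ₂.Below i j
  below₁₂-at-i = Insertion.below-preserved pt₁ pt₂ i agree₁₂ agree₂₁ sizes₁₂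

  below₂₁-at-i : ∀ {j} → i < j → ₂.Below i j → ₁.Below i j
  below₂₁-at-i = Insertion.below-preserved pt₂ pt₁ i agree₂₁ agree₁₂ sizes₂₁

  above₁₂-at-i : ∀ {j} → i < j → ₁.Above i j → ₂.Above i j
  above₁₂-at-i i<j i↑j = ₂.¬below⇒above (>⇒≢ i<j) λ i↓₂j → ₁.below⇒¬above (below₂₁-at-i i<j i↓₂j) i↑j

  above₂₁-at-i : ∀ {j} → i < j → ₂.Above i j → ₁.Above i j
  above₂₁-at-i i<j i↑₂j = ₁.¬below⇒above (>⇒≢ i<j) λ i↓j → ₂.below⇒¬above (below₁₂-at-i i<j i↓j) i↑₂j

  nearest-below-transfers : ∀ {c} → ₁.NearestLargerBelow i c → ₂.NearestLargerBelow i c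
  nearest-below-transfers nc₁@(i<c , i↓c , _ , _) with ₂.nearest-exists i<c (below₁₂-at-i i<c i↓c)
  ... | c₂ , nc₂@(i<c₂ , i↓₂c₂ , _ , _) , _ =
    subst (₂.NearestLargerBelow i) (sym (nearest-below-agree nc₁ nc₂ (below₂₁-at-i i<c₂ i↓₂c₂) (below₁₂-at-i i<c i↓c))) nc₂

  nearest-above-transfers : ∀ {p} → N₁.NearestLargerAbove i p → N₂.NearestLargerAbove i p
  nearest-above-transfers np₁@(i<p , i↑p , _ , _) with ₂ʳ.nearest-exists i<p (above₁₂-at-i i<p i↑p)
  ... | p₂ , np₂@(i<p₂ , i↑₂p₂ , _ , _) , _ =
    subst (N₂.NearestLargerAbove i) (sym (nearest-above-agree np₁ np₂ (above₂₁-at-i i<p₂ i↑₂p₂) (above₁₂-at-i i<p i↑p))) np₂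

  neighbour-transfers : ∀ {w} → N₁.NearestNeighbour i w → N₂.NearestNeighbour i w
  neighbour-transfers = Sum.map nearest-below-transfers nearest-above-transfers

  joined-i₁₂ : ∀ {z y} → i < z → i < y → ₁.Joined z i y → ₂.Joined z i y
  joined-i₁₂ i<z i<y r with N₁.joined⇒via-neighbour i<z i<y r
  ... | w , nw , w≢z , r′ = N₂.via-neighbour⇒joined i<z (neighbour-transfers nw) w≢z
                              (joined₁₂ i<z (N₁.NearestNeighbour-larger nw) i<y r′)

  below-to-i₁₂ : ∀ {x} → i < x → ₁.Below x i → ₂.Below x i
  below-to-i₁₂ i<x x↓i with N₁.below⇒via-neighbour i<x x↓i
  ... | inj₁ np = N₂.via-neighbour⇒below i<x (inj₁ (nearest-above-transfers np))
  ... | inj₂ (w , nw , w≢x , x↓w) = N₂.via-neighbour⇒below i<x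
          (inj₂ (w , neighbour-transfers nw , w≢x , below₁₂ i<x (N₁.NearestNeighbour-larger nw) x↓w))

  private
    larger-or-equal : ∀ {v} → toℕ i N.≤ toℕ v → i < v ⊎ v ≡ i
    larger-or-equal i≤v with NP.m≤n⇒m<n∨m≡n i≤v
    ... | inj₁ i<v = inj₁ i<v
    ... | inj₂ i≡v = inj₂ (toℕ-injective (sym i≡v))

  joined-from-i : ∀ {z x y} → toℕ i N.≤ toℕ z → toℕ i N.≤ toℕ x → toℕ i N.≤ toℕ y → ₁.Joined z x y → ₂.Joined z x y
  joined-from-i {z} {x} {y} i≤z i≤x i≤y r with larger-or-equal {z} i≤z | larger-or-equal {x} i≤x | larger-or-equal {y} i≤y
  ... | inj₁ i<z | inj₁ i<x | inj₁ i<y = joined₁₂ i<z i<x i<y r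
  ... | inj₁ i<z | inj₂ refl | inj₂ refl = ε
  ... | inj₁ i<z | inj₂ refl | inj₁ i<y = joined-i₁₂ i<z i<y r
  ... | inj₁ i<z | inj₁ i<x | inj₂ refl = ₂.Joined-sym (joined-i₁₂ i<z i<x (₁.Joined-sym r))
  ... | inj₂ refl | inj₂ refl | _ with ₁.Joined-from-centre r
  ...   | refl = ε
  joined-from-i _ _ _ r | inj₂ refl | inj₁ _ | inj₂ refl with ₁.Joined-to-centre r
  ...   | refl = ε
  joined-from-i _ _ _ r | inj₂ refl | inj₁ i<x | inj₁ i<y with N₁.joined⇒same-side i<x r
  ...   | inj₁ (i↓x , i↓y) = ₂.larger-below-joined i<x i<y (below₁₂-at-i i<x i↓x) (below₁₂-at-i i<y i↓y)
  ...   | inj₂ (i↑x , i↑y) = ₂.larger-above-joined i<x i<y (above₁₂-at-i i<x i↑x) (above₁₂-at-i i<y i↑y)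

  below-from-i : ∀ {x y} → toℕ i N.≤ toℕ x → toℕ i N.≤ toℕ y → ₁.Below x y → ₂.Below x y
  below-from-i {x} {y} i≤x i≤y x↓y with larger-or-equal {x} i≤x | larger-or-equal {y} i≤y
  ... | inj₁ i<x | inj₁ i<y = below₁₂ i<x i<y x↓y
  ... | inj₁ i<x | inj₂ refl = below-to-i₁₂ i<x x↓y
  ... | inj₂ refl | inj₁ i<y = below₁₂-at-i i<y x↓y
  ... | inj₂ refl | inj₂ refl = ⊥-elim (₁.Below-irrefl x↓y)

  agree-from-i : Agree (ChildTree pt₁) (ChildTree pt₂) (toℕ i)
  agree-from-i = record { joined = joined-from-i ; below = below-from-i }

module _ {n : ℕ} {δ : Fin n → Decoration} {E₁ E₂ : Digraph n} (pt₁ : IsPermutree E₁ δ) (pt₂ : IsPermutree E₂ δ)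
  (sizes : ∀ i → CubicSizesAgree δ E₁ E₂ i) where

  -- downward induction on the threshold t = n - d
  agree-above : ∀ d t → d N.+ t ≡ n → Agree (ChildTree pt₁) (ChildTree pt₂) t × Agree (ChildTree pt₂) (ChildTree pt₁) t
  agree-above zero t refl = Agree-beyond , Agree-beyond
  agree-above (suc d) t eq =
    subst (Agree (ChildTree pt₁) (ChildTree pt₂)) toℕi≡t (Descent.agree-from-i pt₁ pt₂ i agree₁₂ agree₂₁ sizes₁₂ sizes₂₁) ,
    subst (Agree (ChildTree pt₂) (ChildTree pt₁)) toℕi≡t (Descent.agree-from-i pt₂ pt₁ i agree₂₁ agree₁₂ sizes₂₁ sizes₁₂)
    where
    t<n : t N.< n
    t<n = subst (t N.<_) eq (N.s≤s (NP.m≤n+m t d))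
    i : Fin n
    i = fromℕ< t<n
    toℕi≡t : toℕ i ≡ t
    toℕi≡t = toℕ-fromℕ< t<n
    above : Agree (ChildTree pt₁) (ChildTree pt₂) (suc t) × Agree (ChildTree pt₂) (ChildTree pt₁) (suc t)
    above = agree-above d (suc t) (trans (NP.+-suc d t) eq)
    agree₁₂ = subst (λ s → Agree (ChildTree pt₁) (ChildTree pt₂) (suc s)) (sym toℕi≡t) (proj₁ above)
    agree₂₁ = subst (λ s → Agree (ChildTree pt₂) (ChildTree pt₁) (suc s)) (sym toℕi≡t) (proj₂ above)
    sizes₁₂ = sizes i
    sizes₂₁ : CubicSizesAgree δ E₂ E₁ i
    sizes₂₁ lt = let k , size₁ , size₂ = sizes i lt in k , size₂ , size₁

theorem3p9 : (n : ℕ) (δ : Fin n → Decoration) →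
    (∀ i → (toℕ i ≡ 0 ⊎ suc (toℕ i) ≡ n) → δ i ≡ none) →
    (T₁ T₂ : Digraph n) → IsPermutree T₁ δ → IsPermutree T₂ δ →
    (∀ (i : Fin n) → suc (toℕ i) N.< n →
    ∃ λ k → CardIs (CubicComponent T₁ δ i) k × CardIs (CubicComponent T₂ δ i) k) →
    ∀ x y → T₁ x y ≡ T₂ x y
-- the boundary convention δ 1 = δ n = none is not needed
theorem3p9 n δ _ T₁ T₂ pt₁ pt₂ sizes x y =
  ⇔→≡ {z = true} (mk⇔ (Agree-everywhere⇒⋖ agree₁₂) (Agree-everywhere⇒⋖ agree₂₁))
  where
  agree₁₂ = proj₁ (agree-above pt₁ pt₂ sizes n 0 (NP.+-identityʳ n))
  agree₂₁ = proj₂ (agree-above pt₁ pt₂ sizes n 0 (NP.+-identityʳ n))
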